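{- Let $m\geq 2$ and let $\mu$ be a proper edge-coloring of the complete graph $K_{2m}$ with $2m-1$ colors such that for any two distinct colors, the edges of those two colors form a 2-factor of $K_{2m}$ each of whose components is a 4-cycle. Then (a) $2m=2^n$ for some integer $n\geq 2$, and (b) for each integer $k$ with $1\leq k\leq n-1$, $K_{2m}$ contains a clique $K$ on $2^k$ vertices such that the set $\{\mu(e) : e\in E(K)\}$ has exactly $2^k-1$ elements, i.e., the restriction of $\mu$ to $K$ is a $(2^k-1)$-edge-coloring of $K$.
   Context: An edge-coloring is proper if any two edges sharing a vertex receive distinct colors. A clique of order $r$ in $K_{2m}$ is the complete subgraph induced by a set of $r$ vertices. -}

module Defs where

open import Data.Nat using (ℕ; _*_; _∸_; _^_)
open import Data.Fin using (Fin)
open import Data.Product using (Σ; ∃; _×_; _,_)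
open import Relation.Binary.PropositionalEquality using (_≡_; _≢_)
open import Relation.Nullary using (¬_)
open import Function.Definitions using (Injective)

-- An edge-coloring of the complete graph K_N on vertex set Fin N with
-- colors Fin C: a function on ordered pairs; only values on distinct
-- pairs matter (diagonal values are irrelevant).
Coloring : ℕ → ℕ → Set
Coloring N C = Fin N → Fin N → Fin C

Symmetric : ∀ {N C} → Coloring N C → Set
Symmetric {N} μ = ∀ (u v : Fin N) → u ≢ v → μ u v ≡ μ v u

Proper : ∀ {N C} → Coloring N C → Set
Proper {N} μ = ∀ (u v w : Fin N) → u ≢ v → u ≢ w → v ≢ w → μ u v ≢ μ u w

-- For colors c ≠ d, the union of the color classes c and d is a 2-factor
-- all of whose components are 4-cycles: every vertex u lies on a 4-cycle
-- u v x w (four distinct vertices) with edges uv, xw of color c and vx, wu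
-- of color d.  (By properness each vertex then has exactly one c-edge and
-- one d-edge, so its component in the c∪d graph is exactly this 4-cycle.)
FourCycleUnion : ∀ {N C} → Coloring N C → Fin C → Fin C → Set
FourCycleUnion {N} μ c d =
  ∀ (u : Fin N) → Σ (Fin N) λ v → Σ (Fin N) λ x → Σ (Fin N) λ w →
    (u ≢ v × u ≢ x × u ≢ w × v ≢ x × v ≢ w × x ≢ w) ×
    (μ u v ≡ c × μ v x ≡ d × μ x w ≡ c × μ w u ≡ d)

AllPairsFourCycles : ∀ {N C} → Coloring N C → Set
AllPairsFourCycles {N} {C} μ = ∀ (c d : Fin C) → c ≢ d → FourCycleUnion μ c d

-- The set of colors {μ(e) : e ∈ E(K)} of a clique K (given by an
-- injective vertex map κ : Fin r → Fin N) has exactly s elements: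
-- it is the image of an injection Fin s → Fin C.
ColorSetHasSize : ∀ {N C r} → Coloring N C → (Fin r → Fin N) → ℕ → Set
ColorSetHasSize {N} {C} {r} μ κ s =
  Σ (Fin s → Fin C) λ f → Injective _≡_ _≡_ f ×
    ((∀ (i j : Fin r) → i ≢ j → ∃ λ t → f t ≡ μ (κ i) (κ j)) ×
     (∀ (t : Fin s) → Σ (Fin r) λ i → Σ (Fin r) λ j → i ≢ j × μ (κ i) (κ j) ≡ f t))

{-# OPTIONS --safe #-}
-- Fix a vertex o and let u ⊕ v be v moved along the matching of colour μ o u (u ≢ o),
-- resp. v itself (u = o).  The four-cycle condition says that any two colour matchings
-- commute; a map commuting with all of them is determined by its value at o, and this
-- makes ⊕ an elementary abelian 2-group on the vertices in which the edge uv has colour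
-- μ o (u ⊕ v).  Adjoining elements one at a time gives subgroups of every order 2^k up to
-- the number of vertices, which is therefore 2^n; a subgroup of order 2^k is a clique whose
-- edges carry exactly the 2^k − 1 colours μ o h, h ≢ o.
module Submission where

open import Defs
open import Data.Nat using (ℕ; zero; suc; _*_; _∸_; _^_; _≤_; _<_; z≤n; s≤s; z<s; s≤s⁻¹)
open import Data.Nat.Properties
  using (≤-refl; ≤-trans; ≤-antisym; +-mono-≤; m≤m+n; m^n>0; m≤n⇒m<n∨m≡n;
         ^-monoʳ-<; *-monoʳ-≤; ∸-monoˡ-≤; m∸n≤m; <⇒≱; ≮⇒≥)
open import Data.Fin using (Fin; zero; suc; _≟_; punchIn; punchOut)
open import Data.Fin.Properties
  using (*↔×; injective⇒≤; <⇒notInjective; any?; all?; ¬∀⟶∃¬;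
         punchInᵢ≢i; punchIn-injective; punchIn-punchOut)
open import Data.Product using (Σ; ∃; _×_; _,_; proj₁; proj₂)
open import Data.Sum using (_⊎_; inj₁; inj₂)
open import Data.Empty using (⊥-elim)
open import Function using (_∘_; _↔_; Inverse)
open import Function.Definitions using (Injective)
open import Relation.Binary.PropositionalEquality
open import Relation.Nullary using (yes; no; contradiction)

n<2^n : ∀ n → n < 2 ^ n
n<2^n zero    = z<s
n<2^n (suc n) = +-mono-≤ (m^n>0 2 n) (≤-trans (n<2^n n) (m≤m+n (2 ^ n) 0))

covering⇒≤ : ∀ {s N} {f : Fin s → Fin N} → (∀ v → ∃ λ i → f i ≡ v) → N ≤ s
covering⇒≤ {f = f} cover = injective⇒≤ {f = proj₁ ∘ cover} λ {v} {w} eq →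
  trans (sym (proj₂ (cover v))) (trans (cong f eq) (proj₂ (cover w)))

covers⊎misses : ∀ {s N} (f : Fin s → Fin N) →
  (∀ v → ∃ λ i → f i ≡ v) ⊎ (∃ λ v → ∀ i → f i ≢ v)
covers⊎misses {N = N} f with all? (λ v → any? (λ i → f i ≟ v))
... | yes cover = inj₁ cover
... | no ¬cover with v , v∉f ← ¬∀⟶∃¬ N _ (λ v → any? (λ i → f i ≟ v)) ¬cover =
  inj₂ (v , λ i eq → v∉f (i , eq))

module ElementaryAbelian2Group
  {N : ℕ} (_⊕_ : Fin N → Fin N → Fin N) (e : Fin N)
  (⊕-identityˡ : ∀ v → e ⊕ v ≡ v)
  (⊕-comm : ∀ u v → u ⊕ v ≡ v ⊕ u)
  (⊕-assoc : ∀ u v w → (u ⊕ v) ⊕ w ≡ u ⊕ (v ⊕ w))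
  (⊕-self : ∀ u → u ⊕ u ≡ e)
  where

  x⊕[x⊕y]≡y : ∀ x y → x ⊕ (x ⊕ y) ≡ y
  x⊕[x⊕y]≡y x y = trans (sym (⊕-assoc x x y)) (trans (cong (_⊕ y) (⊕-self x)) (⊕-identityˡ y))

  ⊕-cancelˡ : ∀ x {y z} → x ⊕ y ≡ x ⊕ z → y ≡ z
  ⊕-cancelˡ x {y} {z} eq =
    trans (sym (x⊕[x⊕y]≡y x y)) (trans (cong (x ⊕_) eq) (x⊕[x⊕y]≡y x z))

  x⊕y≡e⇒x≡y : ∀ {x y} → x ⊕ y ≡ e → x ≡ y
  x⊕y≡e⇒x≡y {x} eq = sym (⊕-cancelˡ x (trans eq (sym (⊕-self x))))

  x≡y⊕z⇒x⊕z≡y : ∀ {x} y z → x ≡ y ⊕ z → x ⊕ z ≡ y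
  x≡y⊕z⇒x⊕z≡y y z refl = begin
    (y ⊕ z) ⊕ z  ≡⟨ cong (_⊕ z) (⊕-comm y z) ⟩
    (z ⊕ y) ⊕ z  ≡⟨ ⊕-assoc z y z ⟩
    z ⊕ (y ⊕ z)  ≡⟨ cong (z ⊕_) (⊕-comm y z) ⟩
    z ⊕ (z ⊕ y)  ≡⟨ x⊕[x⊕y]≡y z y ⟩
    y            ∎
    where open ≡-Reasoning

  x⊕[y⊕z]≡y⊕[x⊕z] : ∀ x y z → x ⊕ (y ⊕ z) ≡ y ⊕ (x ⊕ z)
  x⊕[y⊕z]≡y⊕[x⊕z] x y z = begin
    x ⊕ (y ⊕ z)  ≡⟨ sym (⊕-assoc x y z) ⟩
    (x ⊕ y) ⊕ z  ≡⟨ cong (_⊕ z) (⊕-comm x y) ⟩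
    (y ⊕ x) ⊕ z  ≡⟨ ⊕-assoc y x z ⟩
    y ⊕ (x ⊕ z)  ∎
    where open ≡-Reasoning

  [x⊕y]⊕[x⊕z]≡y⊕z : ∀ x y z → (x ⊕ y) ⊕ (x ⊕ z) ≡ y ⊕ z
  [x⊕y]⊕[x⊕z]≡y⊕z x y z = begin
    (x ⊕ y) ⊕ (x ⊕ z)  ≡⟨ ⊕-assoc x y (x ⊕ z) ⟩
    x ⊕ (y ⊕ (x ⊕ z))  ≡⟨ cong (x ⊕_) (x⊕[y⊕z]≡y⊕[x⊕z] y x z) ⟩
    x ⊕ (x ⊕ (y ⊕ z))  ≡⟨ x⊕[x⊕y]≡y x (y ⊕ z) ⟩
    y ⊕ z              ∎
    where open ≡-Reasoning

  record Subgroup (I : Set) : Set where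
    field
      elem           : I → Fin N
      elem-injective : Injective _≡_ _≡_ elem
      elem-closed    : ∀ i j → ∃ λ l → elem i ⊕ elem j ≡ elem l
      unit           : I
      elem-unit      : elem unit ≡ e

  open Subgroup

  trivial : Subgroup (Fin 1)
  trivial = record
    { elem           = λ _ → e
    ; elem-injective = λ { {zero} {zero} _ → refl }
    ; elem-closed    = λ _ _ → zero , ⊕-identityˡ e
    ; unit           = zero
    ; elem-unit      = refl
    }

  reindex : ∀ {I J} → J ↔ I → Subgroup I → Subgroup J
  reindex {I} {J} J↔I H = record
    { elem           = elem H ∘ to
    ; elem-injective = to-injective ∘ elem-injective H
    ; elem-closed    = closed
    ; unit           = from (unit H)
    ; elem-unit      = trans (cong (elem H) (strictlyInverseˡ (unit H))) (elem-unit H)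
    }
    where
    open Inverse J↔I
    to-injective : Injective _≡_ _≡_ to
    to-injective {i} {j} eq =
      trans (sym (strictlyInverseʳ i)) (trans (cong from eq) (strictlyInverseʳ j))
    closed : ∀ i j → ∃ λ l → elem H (to i) ⊕ elem H (to j) ≡ elem H (to l)
    closed i j with l , eq ← elem-closed H (to i) (to j) =
      from l , trans eq (cong (elem H) (sym (strictlyInverseˡ l)))

  adjoin : ∀ {I} (H : Subgroup I) (y : Fin N) → (∀ i → elem H i ≢ y) → Subgroup (Fin 2 × I)
  adjoin {I} H y y∉H = record
    { elem           = elem′
    ; elem-injective = injective
    ; elem-closed    = closed
    ; unit           = zero , unit H
    ; elem-unit      = elem-unit H
    }
    where
    h : I → Fin N
    h = elem H

    elem′ : Fin 2 × I → Fin N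
    elem′ (zero     , i) = h i
    elem′ (suc zero , i) = y ⊕ h i

    cosets-disjoint : ∀ i j → h i ≢ y ⊕ h j
    cosets-disjoint i j eq with l , eq′ ← elem-closed H i j =
      y∉H l (trans (sym eq′) (x≡y⊕z⇒x⊕z≡y y (h j) eq))

    injective : Injective _≡_ _≡_ elem′
    injective {zero     , i} {zero     , j} eq = cong (zero ,_) (elem-injective H eq)
    injective {zero     , i} {suc zero , j} eq = contradiction eq (cosets-disjoint i j)
    injective {suc zero , i} {zero     , j} eq = contradiction (sym eq) (cosets-disjoint j i)
    injective {suc zero , i} {suc zero , j} eq =
      cong (suc zero ,_) (elem-injective H (⊕-cancelˡ y eq))

    closed : ∀ a b → ∃ λ c → elem′ a ⊕ elem′ b ≡ elem′ c
    closed (zero , i) (zero , j) with l , eq ← elem-closed H i j = (zero , l) , eq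
    closed (zero , i) (suc zero , j) with l , eq ← elem-closed H i j =
      (suc zero , l) , trans (x⊕[y⊕z]≡y⊕[x⊕z] (h i) y (h j)) (cong (y ⊕_) eq)
    closed (suc zero , i) (zero , j) with l , eq ← elem-closed H i j =
      (suc zero , l) , trans (⊕-assoc y (h i) (h j)) (cong (y ⊕_) eq)
    closed (suc zero , i) (suc zero , j) with l , eq ← elem-closed H i j =
      (zero , l) , trans ([x⊕y]⊕[x⊕z]≡y⊕z y (h i) (h j)) eq

  Chain : ℕ → Set
  Chain n = ∀ {k} → k ≤ n → Subgroup (Fin (2 ^ k))

  snoc : ∀ {n} → Chain n → Subgroup (Fin (2 ^ suc n)) → Chain (suc n)
  snoc chain H k≤1+n with m≤n⇒m<n∨m≡n k≤1+n
  ... | inj₁ k<1+n = chain (s≤s⁻¹ k<1+n)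
  ... | inj₂ refl  = H

  record FullChain : Set where
    field
      exponent  : ℕ
      order     : 2 ^ exponent ≡ N
      subgroups : Chain exponent

  extend : ∀ {n} → Chain n → FullChain ⊎ Chain (suc n)
  extend {n} chain with covers⊎misses (elem (chain ≤-refl))
  ... | inj₁ cover = inj₁ record
    { exponent  = n
    ; order     = ≤-antisym (injective⇒≤ (elem-injective (chain ≤-refl))) (covering⇒≤ cover)
    ; subgroups = chain
    }
  ... | inj₂ (y , y∉H) = inj₂ (snoc chain (reindex *↔× (adjoin (chain ≤-refl) y y∉H)))

  fullChainOr : ∀ n → FullChain ⊎ Chain n
  fullChainOr zero    = inj₂ λ { z≤n → trivial }
  fullChainOr (suc n) with fullChainOr n
  ... | inj₁ full  = inj₁ full
  ... | inj₂ chain = extend chain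

  -- A chain of length N would put 2 ^ N distinct elements into Fin N.
  fullChain : FullChain
  fullChain with fullChainOr N
  ... | inj₁ full  = full
  ... | inj₂ chain = ⊥-elim (<⇒notInjective (n<2^n N) (elem-injective (chain ≤-refl)))

module PartnerMatchings
  {N C : ℕ} (μ : Coloring N C) (μ-sym : Symmetric μ) (μ-proper : Proper μ)
  (fourCycles : AllPairsFourCycles μ) (anotherColour : (c : Fin C) → ∃ λ d → d ≢ c)
  where

  neighbour : ∀ c u → ∃ λ v → u ≢ v × μ u v ≡ c
  neighbour c u =
    let d , d≢c = anotherColour c
        v , _ , _ , (u≢v , _) , (μuv≡c , _) = fourCycles c d (≢-sym d≢c) u
    in v , u≢v , μuv≡c

  partner : Fin C → Fin N → Fin N
  partner c u = proj₁ (neighbour c u)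

  partner-≢ : ∀ c u → u ≢ partner c u
  partner-≢ c u = proj₁ (proj₂ (neighbour c u))

  partner-colour : ∀ c u → μ u (partner c u) ≡ c
  partner-colour c u = proj₂ (proj₂ (neighbour c u))

  partner-unique : ∀ {c u v} → u ≢ v → μ u v ≡ c → v ≡ partner c u
  partner-unique {c} {u} {v} u≢v μuv≡c with v ≟ partner c u
  ... | yes v≡partner = v≡partner
  ... | no  v≢partner = contradiction (trans μuv≡c (sym (partner-colour c u)))
                          (μ-proper u v (partner c u) u≢v (partner-≢ c u) v≢partner)

  -- Going round the c-d four-cycle through u both ways.
  partners-commute : ∀ c d u → partner c (partner d u) ≡ partner d (partner c u)
  partners-commute c d u with c ≟ d
  ... | yes refl = refl
  ... | no c≢d
    with v , x , w , (u≢v , _ , u≢w , v≢x , _ , x≢w) , (μuv≡c , μvx≡d , μxw≡c , μwu≡d)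
         ← fourCycles c d c≢d u = begin
    partner c (partner d u)  ≡⟨ cong (partner c) (sym w≡) ⟩
    partner c w              ≡⟨ sym x≡partner-c-w ⟩
    x                        ≡⟨ x≡partner-d-v ⟩
    partner d v              ≡⟨ cong (partner d) v≡ ⟩
    partner d (partner c u)  ∎
    where
    open ≡-Reasoning
    v≡ : v ≡ partner c u
    v≡ = partner-unique u≢v μuv≡c
    w≡ : w ≡ partner d u
    w≡ = partner-unique u≢w (trans (μ-sym u w u≢w) μwu≡d)
    x≡partner-d-v : x ≡ partner d v
    x≡partner-d-v = partner-unique v≢x μvx≡d
    x≡partner-c-w : x ≡ partner c w
    x≡partner-c-w = partner-unique (≢-sym x≢w) (trans (μ-sym w x (≢-sym x≢w)) μxw≡c)

module VertexGroup
  {N C : ℕ} (μ : Coloring N C) (μ-sym : Symmetric μ) (μ-proper : Proper μ)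
  (fourCycles : AllPairsFourCycles μ) (anotherColour : (c : Fin C) → ∃ λ d → d ≢ c)
  (o : Fin N)
  where

  open PartnerMatchings μ μ-sym μ-proper fourCycles anotherColour

  infixr 6 _⊕_

  _⊕_ : Fin N → Fin N → Fin N
  u ⊕ v with u ≟ o
  ... | yes _ = v
  ... | no  _ = partner (μ o u) v

  o⊕v≡v : ∀ v → o ⊕ v ≡ v
  o⊕v≡v v with o ≟ o
  ... | yes _   = refl
  ... | no  o≢o = contradiction refl o≢o

  u⊕v≡partner : ∀ {u} v → u ≢ o → u ⊕ v ≡ partner (μ o u) v
  u⊕v≡partner {u} v u≢o with u ≟ o
  ... | yes u≡o = contradiction u≡o u≢o
  ... | no  _   = refl

  u⊕o≡u : ∀ u → u ⊕ o ≡ u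
  u⊕o≡u u with u ≟ o
  ... | yes u≡o = sym u≡o
  ... | no  u≢o = sym (partner-unique (≢-sym u≢o) refl)

  Central : (Fin N → Fin N) → Set
  Central f = ∀ c w → f (partner c w) ≡ partner c (f w)

  ∘-central : ∀ {f g} → Central f → Central g → Central (f ∘ g)
  ∘-central {f} {g} f-central g-central c w =
    trans (cong f (g-central c w)) (f-central c (g w))

  ⊕-central : ∀ u → Central (u ⊕_)
  ⊕-central u c w with u ≟ o
  ... | yes _ = refl
  ... | no  _ = partners-commute (μ o u) c w

  central-⊕ : ∀ {f} → Central f → ∀ u w → f (u ⊕ w) ≡ u ⊕ f w
  central-⊕ {f} f-central u w with u ≟ o
  ... | yes _ = refl
  ... | no  _ = f-central (μ o u) w

  central-unique : ∀ {f g} → Central f → Central g → f o ≡ g o → ∀ w → f w ≡ g w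
  central-unique {f} {g} f-central g-central fo≡go w = begin
    f w        ≡⟨ cong f (sym (u⊕o≡u w)) ⟩
    f (w ⊕ o)  ≡⟨ central-⊕ f-central w o ⟩
    w ⊕ f o    ≡⟨ cong (w ⊕_) fo≡go ⟩
    w ⊕ g o    ≡⟨ sym (central-⊕ g-central w o) ⟩
    g (w ⊕ o)  ≡⟨ cong g (u⊕o≡u w) ⟩
    g w        ∎
    where open ≡-Reasoning

  ⊕-comm : ∀ u v → u ⊕ v ≡ v ⊕ u
  ⊕-comm u v = begin
    u ⊕ v        ≡⟨ cong (u ⊕_) (sym (u⊕o≡u v)) ⟩
    u ⊕ v ⊕ o    ≡⟨ central-⊕ (⊕-central u) v o ⟩
    v ⊕ u ⊕ o    ≡⟨ cong (v ⊕_) (u⊕o≡u u) ⟩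
    v ⊕ u        ∎
    where open ≡-Reasoning

  ⊕-assoc : ∀ u v w → (u ⊕ v) ⊕ w ≡ u ⊕ v ⊕ w
  ⊕-assoc u v = central-unique (⊕-central (u ⊕ v)) (∘-central (⊕-central u) (⊕-central v))
    (trans (u⊕o≡u (u ⊕ v)) (cong (u ⊕_) (sym (u⊕o≡u v))))

  u⊕u≡o : ∀ u → u ⊕ u ≡ o
  u⊕u≡o u with u ≟ o
  ... | yes u≡o = u≡o
  ... | no  u≢o = sym (partner-unique u≢o (μ-sym u o u≢o))

  open ElementaryAbelian2Group _⊕_ o o⊕v≡v ⊕-comm ⊕-assoc u⊕u≡o public

  colour-⊕ : ∀ {u v} → u ≢ v → μ u v ≡ μ o (u ⊕ v)
  colour-⊕ {u} {v} u≢v = begin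
    μ u v                          ≡⟨ cong (μ u) v≡partner ⟩
    μ u (partner (μ o (u ⊕ v)) u)  ≡⟨ partner-colour (μ o (u ⊕ v)) u ⟩
    μ o (u ⊕ v)                    ∎
    where
    open ≡-Reasoning
    u⊕v≢o : u ⊕ v ≢ o
    u⊕v≢o = u≢v ∘ x⊕y≡e⇒x≡y
    v≡partner : v ≡ partner (μ o (u ⊕ v)) u
    v≡partner = begin
      v                          ≡⟨ sym (x⊕[x⊕y]≡y u v) ⟩
      u ⊕ u ⊕ v                  ≡⟨ ⊕-comm u (u ⊕ v) ⟩
      (u ⊕ v) ⊕ u                ≡⟨ u⊕v≡partner u u⊕v≢o ⟩
      partner (μ o (u ⊕ v)) u    ∎

  μo-injective : ∀ {a b} → a ≢ o → b ≢ o → μ o a ≡ μ o b → a ≡ b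
  μo-injective {a} {b} a≢o b≢o μoa≡μob =
    trans (partner-unique (≢-sym a≢o) μoa≡μob) (sym (partner-unique (≢-sym b≢o) refl))

  open Subgroup

  -- The colours are the μ o h for h ∈ H ∖ {o}, indexed via punchIn at the position of o.
  subgroup-colours : ∀ {s} (H : Subgroup (Fin s)) → ColorSetHasSize μ (elem H) (s ∸ 1)
  subgroup-colours {suc r} H = colour , colour-injective , covered , realised
    where
    h : Fin (suc r) → Fin N
    h = elem H
    i₀ : Fin (suc r)
    i₀ = unit H

    h≡o⇒i₀ : ∀ {i} → h i ≡ o → i₀ ≡ i
    h≡o⇒i₀ h≡o = elem-injective H (trans (elem-unit H) (sym h≡o))

    colour : Fin r → Fin C
    colour t = μ o (h (punchIn i₀ t))

    h-punchIn-≢o : ∀ t → h (punchIn i₀ t) ≢ o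
    h-punchIn-≢o t = punchInᵢ≢i i₀ t ∘ sym ∘ h≡o⇒i₀

    colour-injective : Injective _≡_ _≡_ colour
    colour-injective {t} {t′} eq =
      punchIn-injective i₀ t t′
        (elem-injective H (μo-injective (h-punchIn-≢o t) (h-punchIn-≢o t′) eq))

    covered : ∀ i j → i ≢ j → ∃ λ t → colour t ≡ μ (h i) (h j)
    covered i j i≢j with l , hi⊕hj≡hl ← elem-closed H i j = punchOut i₀≢l , (begin
      μ o (h (punchIn i₀ (punchOut i₀≢l)))  ≡⟨ cong (μ o ∘ h) (punchIn-punchOut i₀≢l) ⟩
      μ o (h l)                             ≡⟨ cong (μ o) (sym hi⊕hj≡hl) ⟩
      μ o (h i ⊕ h j)                       ≡⟨ sym (colour-⊕ hi≢hj) ⟩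
      μ (h i) (h j)                         ∎)
      where
      open ≡-Reasoning
      hi≢hj : h i ≢ h j
      hi≢hj = i≢j ∘ elem-injective H
      i₀≢l : i₀ ≢ l
      i₀≢l i₀≡l =
        hi≢hj (x⊕y≡e⇒x≡y (trans hi⊕hj≡hl (trans (cong h (sym i₀≡l)) (elem-unit H))))

    realised : ∀ t → Σ (Fin (suc r)) λ i → Σ (Fin (suc r)) λ j → i ≢ j × μ (h i) (h j) ≡ colour t
    realised t = i₀ , punchIn i₀ t , ≢-sym (punchInᵢ≢i i₀ t) ,
      cong (λ x → μ x (h (punchIn i₀ t))) (elem-unit H)

anotherColour : ∀ {C} → 2 ≤ C → (c : Fin C) → ∃ λ d → d ≢ c
anotherColour (s≤s (s≤s _)) c = punchIn c zero , punchInᵢ≢i c zero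

2≤exponent : ∀ {m n} → 2 ≤ m → 2 * m ≡ 2 ^ n → 2 ≤ n
2≤exponent 2≤m 2m≡2^n = ≮⇒≥ λ n<2 →
  <⇒≱ (^-monoʳ-< 2 (s≤s (s≤s z≤n)) n<2) (subst (4 ≤_) 2m≡2^n (*-monoʳ-≤ 2 2≤m))

lemma2 : (m : ℕ) → 2 ≤ m → (μ : Coloring (2 * m) (2 * m ∸ 1)) →
    Symmetric μ → Proper μ → AllPairsFourCycles μ →
    Σ ℕ λ n → 2 ≤ n × 2 * m ≡ 2 ^ n ×
      (∀ (k : ℕ) → 1 ≤ k → k ≤ n ∸ 1 →
        Σ (Fin (2 ^ k) → Fin (2 * m)) λ κ → Injective _≡_ _≡_ κ ×
          ColorSetHasSize μ κ (2 ^ k ∸ 1))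
lemma2 m 2≤m@(s≤s (s≤s _)) μ μ-sym μ-proper fourCycles =
  n , 2≤exponent 2≤m (sym order) , sym order , clique
  where
  2≤colours : 2 ≤ 2 * m ∸ 1
  2≤colours = ≤-trans (s≤s (s≤s z≤n)) (∸-monoˡ-≤ 1 (*-monoʳ-≤ 2 2≤m))

  open VertexGroup μ μ-sym μ-proper fourCycles (anotherColour 2≤colours) zero
  open Subgroup
  open FullChain fullChain renaming (exponent to n)

  clique : ∀ k → 1 ≤ k → k ≤ n ∸ 1 →
    Σ (Fin (2 ^ k) → Fin (2 * m)) λ κ → Injective _≡_ _≡_ κ × ColorSetHasSize μ κ (2 ^ k ∸ 1)
  clique k _ k≤n∸1 = elem H , elem-injective H , subgroup-colours H
    where
    H : Subgroup (Fin (2 ^ k))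
    H = subgroups (≤-trans k≤n∸1 (m∸n≤m n 1))
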